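{- Let $G$ be a graph with minimum degree at least $3$ and maximum degree $s$. Then $Ex(Cl(G))\ge\frac{1}{s}Ex(G)$.
   Context: The clustering $Cl(G)$ of an undirected graph $G$ has a vertex $(u,v)$ for each ordered pair with $\{u,v\}\in E(G)$ (so two vertices $(u,v),(v,u)$ per edge), and edges $\{(u,v),(v,u)\}$ for every $\{u,v\}\in E(G)$ together with $\{(u,v_1),(u,v_2)\}$ for all $v_1\ne v_2$ with $\{u,v_1\},\{u,v_2\}\in E(G)$. Expansion: for a graph $H$ and $S\subseteq V(H)$, $Ex(S)=|E(S,V(H)\setminus S)|/\min\{|S|,|V(H)\setminus S|\}$, with $E(S,T)$ the set of edges between $S$ and $T$; $Ex(H)=\min Ex(S)$ over nonempty proper subsets $S$. -}

module Defs where

open import Data.Bool using (Bool; true; false; _∧_; _∨_; not; if_then_else_)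
open import Data.Nat using (ℕ; zero; suc; _<ᵇ_; _⊓_) renaming (_≡ᵇ_ to _==ℕ_)
open import Data.Fin using (Fin; toℕ)
open import Data.Product using (_×_; _,_)
open import Data.List using (List; []; _∷_; map; concatMap; filterᵇ; length; lookup; allFin; foldr)
open import Data.Vec using (Vec; []; _∷_; tabulate; toList)
import Data.Vec as Vec
open import Data.Nat.ListAction using (sum)
open import Data.Integer using (+_)
open import Data.Rational using (ℚ; _/_; 0ℚ) renaming (_⊓_ to _⊓ℚ_)
open import Relation.Binary.PropositionalEquality using (_≡_)

record Graph : Set where
  constructor graph
  field
    n   : ℕ
    adj : Fin n → Fin n → Bool
open Graph public

IsSimple : Graph → Set
IsSimple G = (∀ u v → adj G u v ≡ adj G v u) × (∀ u → adj G u u ≡ false)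

_==_ : ∀ {n} → Fin n → Fin n → Bool
i == j = toℕ i ==ℕ toℕ j

countTrue : ∀ {k} → Vec Bool k → ℕ
countTrue v = length (filterᵇ (λ b → b) (toList v))

degree : (G : Graph) → Fin (n G) → ℕ
degree G u = countTrue (tabulate (adj G u))

-- vertex subsets as characteristic vectors
allSubsets : (k : ℕ) → List (Vec Bool k)
allSubsets zero    = [] ∷ []
allSubsets (suc k) = concatMap (λ S → (true ∷ S) ∷ (false ∷ S) ∷ []) (allSubsets k)

cut : (G : Graph) → Vec Bool (n G) → ℕ
cut G S = sum (map (λ i → sum (map (λ j →
            if Vec.lookup S i ∧ not (Vec.lookup S j) ∧ adj G i j then 1 else 0)
            (allFin (n G)))) (allFin (n G)))

-- a / b as a rational (only used with b ≥ 1)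
frac : ℕ → ℕ → ℚ
frac a zero    = 0ℚ
frac a (suc b) = (+ a) / suc b

ExS : (G : Graph) → Vec Bool (n G) → ℚ
ExS G S = frac (cut G S) (countTrue S ⊓ (n G Data.Nat.∸ countTrue S))

properSubsets : (G : Graph) → List (Vec Bool (n G))
properSubsets G = filterᵇ (λ S → (0 <ᵇ countTrue S) ∧ (countTrue S <ᵇ n G)) (allSubsets (n G))

minList : List ℚ → ℚ
minList []       = 0ℚ   -- unused default (no nonempty proper subsets)
minList (x ∷ xs) = foldr _⊓ℚ_ x xs

Ex : Graph → ℚ
Ex G = minList (map (ExS G) (properSubsets G))

-- the clustering Cl(G): vertices are the ordered pairs (u,v) with u ~ v
darts : (G : Graph) → List (Fin (n G) × Fin (n G))
darts G = concatMap (λ u → map (λ v → (u , v)) (filterᵇ (adj G u) (allFin (n G)))) (allFin (n G))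

clAdj : ∀ {k} → (Fin k × Fin k) → (Fin k × Fin k) → Bool
clAdj (u , v) (u' , v') = (u == v' ∧ v == u') ∨ (u == u' ∧ not (v == v'))

Cl : Graph → Graph
Cl G = graph (length (darts G)) (λ a b → clAdj (lookup (darts G) a) (lookup (darts G) b))

module Submission where

-- Write Ex(G) = P/Q. A set T of vertices of Cl(G) is a set τ of darts; at a vertex u let a(u), b(u) be the
-- numbers of darts at u inside and outside τ, so a + b = deg u. Among the edges of Cl(G) leaving τ are the
-- twin edges {(u,v),(v,u)} crossing τ and the a(u)·b(u) crossing edges of each cluster (forcedCut). Let X be
-- the set of vertices at which τ holds a strict majority of darts. Every edge of G leaving X is paid for by a
-- crossing twin edge or by a dart on the wrong side at an endpoint, and since deg ≥ 3 each vertex can pay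
-- b(u) (u ∈ X) or 2a(u) (u ∉ X) out of a(u)b(u): cut(X) + Σ_{u∉X} a(u) ≤ forcedCut(τ). With |τ| ≤ s|X| +
-- Σ_{u∉X} a(u), P ≤ sQ and, if |X| ≤ n/2, P|X| ≤ Q·cut(X), this gives P|τ| ≤ sQ·cut_Cl(τ); otherwise the
-- complement of τ, whose majority set is disjoint from X, satisfies the same bound.

module ClusteringExpansion where

  open import Data.Bool using (Bool; true; false; _∧_; _∨_; not; if_then_else_; T)
  open import Data.Bool.Properties using (not-involutive; ∧-identityʳ; ∨-zeroʳ; T-∧)
  open import Data.Empty using (⊥; ⊥-elim)
  open import Data.Fin using (Fin; zero; suc; fromℕ<)
  import Data.Fin as Fin
  open import Data.Integer as ℤ using (-[1+_])
  import Data.Integer.Properties as ℤ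
  open import Data.List using (List; []; _∷_; _++_; map; concatMap; filterᵇ; length; lookup; allFin; tabulate; foldr)
  open import Data.List.Membership.Propositional using (_∈_)
  open import Data.List.Membership.Propositional.Properties using (∈-map⁺; ∈-map⁻; ∈-filter⁺; ∈-filter⁻; ∈-concat⁺′; ∈-lookup)
  open import Data.List.Properties using (map-tabulate; map-++; map-∘; map-cong)
  open import Data.List.Relation.Unary.All as All using (All)
  import Data.List.Relation.Unary.All.Properties as All
  open import Data.List.Relation.Unary.AllPairs as AllPairs using ([]; _∷_)
  import Data.List.Relation.Unary.AllPairs.Properties as AllPairs
  open import Data.List.Relation.Unary.Any using (here; there)
  open import Data.List.Relation.Unary.Unique.Propositional using (Unique)
  import Data.List.Relation.Unary.Unique.Propositional.Properties as Unique
  open import Data.Nat using (ℕ; zero; suc; _+_; _*_; _≤_; _<_; _∸_; _⊓_; _<ᵇ_; z≤n; s≤s; _≤?_)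
  open import Data.Nat.Coprimality using (Coprime)
  open import Data.Nat.ListAction using (sum)
  open import Data.Nat.ListAction.Properties using (sum-++)
  open import Data.Nat.Properties
  open import Data.Nat.Tactic.RingSolver using (solve-∀)
  open import Data.Product using (_×_; _,_; proj₁; proj₂; ∃)
  open import Data.Product.Properties using (≡-dec)
  open import Data.Rational as ℚ using (ℚ; mkℚ; 0ℚ)
  import Data.Rational.Properties as ℚ
  open import Data.Rational.Unnormalised as ℚᵘ using (mkℚᵘ)
  import Data.Rational.Unnormalised.Properties as ℚᵘ
  open import Data.Sum using (_⊎_; inj₁; inj₂)
  open import Data.Unit using (tt)
  open import Data.Vec using (Vec; []; _∷_)
  import Data.Vec as Vec
  open import Data.Vec.Properties using (lookup∘tabulate)
  open import Function using (_∘_; id; Equivalence)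
  open import Relation.Binary.Definitions using (DecidableEquality)
  open import Relation.Binary.PropositionalEquality
  open import Relation.Nullary using (¬_; does; yes; no)
  open import Relation.Nullary.Decidable using (T?)
  open import Defs
  open import Algebra.Properties.Semiring.Sum +-*-semiring
    using (sum-syntax; sum-cong-≗; ∑-distrib-+; ∑-comm; *-distribˡ-sum; *-distribʳ-sum; sum-replicate-zero)
    renaming (sum to ∑)

  ⟦_⟧ : Bool → ℕ
  ⟦ b ⟧ = if b then 1 else 0

  when : Bool → ℕ → ℕ
  when b k = if b then k else 0

  when-+ : ∀ b k l → when b (k + l) ≡ when b k + when b l
  when-+ true  k l = refl
  when-+ false k l = refl

  when-mono : ∀ b {k l} → k ≤ l → when b k ≤ when b l
  when-mono true  k≤l = k≤l
  when-mono false _   = z≤n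

  ∑-mono : ∀ {n} {f g : Fin n → ℕ} → (∀ i → f i ≤ g i) → ∑ f ≤ ∑ g
  ∑-mono {zero}  f≤g = z≤n
  ∑-mono {suc n} f≤g = +-mono-≤ (f≤g zero) (∑-mono (f≤g ∘ suc))

  ∑-term : ∀ {n} (f : Fin n → ℕ) u → f u ≤ ∑ f
  ∑-term f zero    = m≤m+n _ _
  ∑-term f (suc u) = ≤-trans (∑-term (f ∘ suc) u) (m≤n+m _ _)

  ∑-two-terms : ∀ {n} (f : Fin n → ℕ) {u v} → ¬ u ≡ v → f u + f v ≤ ∑ f
  ∑-two-terms f {zero}  {zero}  u≢v = ⊥-elim (u≢v refl)
  ∑-two-terms f {zero}  {suc v} u≢v = +-monoʳ-≤ (f zero) (∑-term (f ∘ suc) v)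
  ∑-two-terms f {suc u} {zero}  u≢v =
    ≤-trans (≤-reflexive (+-comm (f (suc u)) (f zero))) (+-monoʳ-≤ (f zero) (∑-term (f ∘ suc) u))
  ∑-two-terms f {suc u} {suc v} u≢v =
    ≤-trans (∑-two-terms (f ∘ suc) (u≢v ∘ cong suc)) (m≤n+m _ _)

  ∑-when : ∀ {n} b (f : Fin n → ℕ) → when b (∑ f) ≡ ∑ (λ i → when b (f i))
  ∑-when true  f = refl
  ∑-when {n} false f = sym (sum-replicate-zero n)

  ∑-indicator-≤ : ∀ {n} (X : Fin n → Bool) → ∑ (λ i → ⟦ X i ⟧) ≤ n
  ∑-indicator-≤ {zero}  X = z≤n
  ∑-indicator-≤ {suc n} X = +-mono-≤ (indicator-≤ (X zero)) (∑-indicator-≤ (X ∘ suc))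
    where
    indicator-≤ : ∀ b → ⟦ b ⟧ ≤ 1
    indicator-≤ true  = ≤-refl
    indicator-≤ false = z≤n

  ∑-singleton : ∀ {n} (v : Fin n) (f : Fin n → ℕ) → ∑ (λ i → when (i == v) (f i)) ≡ f v
  ∑-singleton {suc n} zero    f = trans (cong (f zero +_) (sum-replicate-zero n)) (+-identityʳ (f zero))
  ∑-singleton {suc n} (suc v) f = ∑-singleton v (f ∘ suc)

  ==-refl : ∀ {k} (i : Fin k) → (i == i) ≡ true
  ==-refl zero    = refl
  ==-refl (suc i) = ==-refl i

  ==⇒≡ : ∀ {k} (i j : Fin k) → (i == j) ≡ true → i ≡ j
  ==⇒≡ zero    zero    _ = refl
  ==⇒≡ (suc i) (suc j) e = cong suc (==⇒≡ i j e)

  twin-adjacent : ∀ {k} (u v : Fin k) → clAdj (u , v) (v , u) ≡ true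
  twin-adjacent u v rewrite ==-refl u | ==-refl v = refl

  sibling-adjacent : ∀ {k} (u : Fin k) {v v'} → ¬ v ≡ v' → clAdj (u , v) (u , v') ≡ true
  sibling-adjacent u {v} {v'} v≢v' with v == v' in v=v'
  ... | true  = ⊥-elim (v≢v' (==⇒≡ v v' v=v'))
  ... | false rewrite ==-refl u = ∨-zeroʳ _

  ∑∑-distrib-+ : ∀ {m n} (f g : Fin m → Fin n → ℕ) →
                 ∑[ i < m ] ∑[ j < n ] (f i j + g i j) ≡ ∑[ i < m ] ∑[ j < n ] f i j + ∑[ i < m ] ∑[ j < n ] g i j
  ∑∑-distrib-+ {m} {n} f g = trans (sum-cong-≗ {m} λ i → ∑-distrib-+ {n} (f i) (g i)) (∑-distrib-+ {m} _ _)

  -- The accounting at one vertex with a chosen and b unchosen darts. If the chosen darts are a strict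
  -- majority then a ≥ 1, so b ≤ a·b; otherwise a ≤ b, and a + b ≥ 3 forces b ≥ 2 unless a = 0, so 2a ≤ a·b.
  majority-pays : ∀ a b → a + b < 2 * a → b ≤ a * b
  majority-pays (suc a) b _ = m≤m+n b (a * b)

  minority-pays : ∀ a b → 3 ≤ a + b → a ≤ b → a + a ≤ a * b
  minority-pays zero          b             _ _ = z≤n
  minority-pays (suc a)       (suc (suc b)) _ _ =
    ≤-trans (≤-reflexive (double (suc a))) (*-monoʳ-≤ (suc a) (s≤s (s≤s z≤n)))
    where
    double : ∀ x → x + x ≡ x * 2
    double = solve-∀
  minority-pays (suc zero)    (suc zero)    (s≤s (s≤s ())) _
  minority-pays (suc (suc a)) (suc zero)    _ (s≤s ())

  vertex-weight : ∀ a b d → a + b ≡ d → 3 ≤ d →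
                  when (d <ᵇ 2 * a) b + when (not (d <ᵇ 2 * a)) (a + a) ≤ a * b
  vertex-weight a b .(a + b) refl 3≤d with a + b <ᵇ 2 * a in eq
  ... | true  = ≤-trans (≤-reflexive (+-identityʳ b)) (majority-pays a b (<ᵇ⇒< _ _ (subst T (sym eq) tt)))
  ... | false = minority-pays a b 3≤d (+-cancelˡ-≤ a a b (≤-trans (≤-reflexive (cong (a +_) (sym (+-identityʳ a)))) 2a≤d))
    where
    2a≤d : 2 * a ≤ a + b
    2a≤d = ≮⇒≥ (λ lt → subst T eq (<⇒<ᵇ lt))

  majority-larger : ∀ a b → a + b < 2 * a → b < a
  majority-larger a b a-maj = +-cancelˡ-< a b a (≤-trans a-maj (≤-reflexive (cong (a +_) (+-identityʳ a))))

  no-two-majorities : ∀ a b → a + b < 2 * a → a + b < 2 * b → ⊥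
  no-two-majorities a b a-maj b-maj =
    <-asym (majority-larger a b a-maj) (majority-larger b a (subst (_< 2 * b) (+-comm a b) b-maj))

  module Clustering {n : ℕ} (A : Fin n → Fin n → Bool)
                    (A-sym : ∀ u v → A u v ≡ A v u) (A-irr : ∀ u → A u u ≡ false) where

    size : (Fin n → Bool) → ℕ
    size X = ∑[ u < n ] ⟦ X u ⟧

    deg : Fin n → ℕ
    deg u = ∑[ v < n ] ⟦ A u v ⟧

    cutG : (Fin n → Bool) → ℕ
    cutG X = ∑[ i < n ] ∑[ j < n ] ⟦ X i ∧ not (X j) ∧ A i j ⟧

    Expands : ℕ → ℕ → Set
    Expands P Q = ∀ X → 2 * size X ≤ n → P * size X ≤ cutG X * Q

    -- A set of darts, i.e. of vertices of Cl(G): τ u v says that (u , v) belongs to it.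
    DartSet : Set
    DartSet = Fin n → Fin n → Bool

    complement : DartSet → DartSet
    complement τ u v = not (τ u v)

    inside outside : DartSet → Fin n → ℕ
    inside  τ u = ∑[ v < n ] when (A u v) ⟦ τ u v ⟧
    outside τ u = ∑[ v < n ] when (A u v) ⟦ not (τ u v) ⟧

    inside+outside : ∀ τ u → inside τ u + outside τ u ≡ deg u
    inside+outside τ u = trans (sym (∑-distrib-+ {n} _ _)) (sum-cong-≗ {n} λ v → split (A u v) (τ u v))
      where
      split : ∀ c t → when c ⟦ t ⟧ + when c ⟦ not t ⟧ ≡ ⟦ c ⟧
      split true  true  = refl
      split true  false = refl
      split false t     = refl

    outside-complement : ∀ τ u → outside (complement τ) u ≡ inside τ u
    outside-complement τ u = sum-cong-≗ {n} λ v → cong (λ t → when (A u v) ⟦ t ⟧) (not-involutive (τ u v))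

    leaving : DartSet → Fin n → Fin n → ℕ
    leaving τ u v = ∑[ u' < n ] ∑[ v' < n ] when (A u' v') ⟦ τ u v ∧ not (τ u' v') ∧ clAdj (u , v) (u' , v') ⟧

    cutCl : DartSet → ℕ
    cutCl τ = ∑[ u < n ] ∑[ v < n ] when (A u v) (leaving τ u v)

    crossTwins : DartSet → ℕ
    crossTwins τ = ∑[ u < n ] ∑[ v < n ] when (A u v) ⟦ τ u v ∧ not (τ v u) ⟧

    forcedCut : DartSet → ℕ
    forcedCut τ = crossTwins τ + ∑[ u < n ] (inside τ u * outside τ u)

    siblingsLeaving : DartSet → Fin n → Fin n → ℕ
    siblingsLeaving τ u v = ∑[ v' < n ] when (A u v') ⟦ τ u v ∧ not (τ u v') ⟧

    inside*outside : ∀ τ u → inside τ u * outside τ u ≡ ∑[ v < n ] when (A u v) (siblingsLeaving τ u v)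
    inside*outside τ u = begin
      inside τ u * outside τ u                                   ≡⟨ *-distribʳ-sum {n} (outside τ u) _ ⟩
      ∑[ v < n ] (when (A u v) ⟦ τ u v ⟧ * outside τ u)          ≡⟨ sum-cong-≗ {n} (λ v → when-* (A u v) _ _) ⟩
      ∑[ v < n ] when (A u v) (⟦ τ u v ⟧ * outside τ u)          ≡⟨ sum-cong-≗ {n} (λ v → cong (when (A u v)) (*-distribˡ-sum {n} ⟦ τ u v ⟧ _)) ⟩
      ∑[ v < n ] when (A u v) (∑[ v' < n ] (⟦ τ u v ⟧ * when (A u v') ⟦ not (τ u v') ⟧))
        ≡⟨ sum-cong-≗ {n} (λ v → cong (when (A u v)) (sum-cong-≗ {n} λ v' → indicator-* (τ u v) (A u v') (τ u v'))) ⟩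
      ∑[ v < n ] when (A u v) (siblingsLeaving τ u v)            ∎
      where
      open ≡-Reasoning
      when-* : ∀ c k l → when c k * l ≡ when c (k * l)
      when-* true  k l = refl
      when-* false k l = refl
      indicator-* : ∀ x c y → ⟦ x ⟧ * when c ⟦ not y ⟧ ≡ when c ⟦ x ∧ not y ⟧
      indicator-* true  true  y = +-identityʳ _
      indicator-* true  false y = refl
      indicator-* false true  y = refl
      indicator-* false false y = refl

    -- A chosen dart (u , v) has in Cl(G) its twin (v , u) and its siblings (u , v') as distinct neighbours.
    twin-and-siblings : ∀ τ u v → A u v ≡ true →
                        ⟦ τ u v ∧ not (τ v u) ⟧ + siblingsLeaving τ u v ≤ leaving τ u v
    twin-and-siblings τ u v Auv = ≤-trans (+-mono-≤ twin siblings) (∑-two-terms F v≢u)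
      where
      F : Fin n → ℕ
      F u' = ∑[ v' < n ] when (A u' v') ⟦ τ u v ∧ not (τ u' v') ∧ clAdj (u , v) (u' , v') ⟧
      v≢u : ¬ v ≡ u
      v≢u v≡u with trans (sym Auv) (trans (cong (A u) v≡u) (A-irr u))
      ... | ()
      twin : ⟦ τ u v ∧ not (τ v u) ⟧ ≤ F v
      twin = ≤-trans (≤-reflexive eq) (∑-term _ u)
        where
        eq : ⟦ τ u v ∧ not (τ v u) ⟧ ≡ when (A v u) ⟦ τ u v ∧ not (τ v u) ∧ clAdj (u , v) (v , u) ⟧
        eq rewrite trans (A-sym v u) Auv | twin-adjacent u v | ∧-identityʳ (not (τ v u)) = refl
      distinct : ∀ {v'} → τ u v ≡ true → τ u v' ≡ false → ¬ v ≡ v'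
      distinct chosen unchosen refl with trans (sym chosen) unchosen
      ... | ()
      sibling : ∀ v' → ⟦ τ u v ∧ not (τ u v') ⟧ ≤ ⟦ τ u v ∧ not (τ u v') ∧ clAdj (u , v) (u , v') ⟧
      sibling v' with τ u v in chosen | τ u v' in unchosen
      ... | true  | false rewrite sibling-adjacent u (distinct chosen unchosen) = ≤-refl
      ... | true  | true  = z≤n
      ... | false | _     = z≤n
      siblings : siblingsLeaving τ u v ≤ F u
      siblings = ∑-mono λ v' → when-mono (A u v') (sibling v')

    forcedCut≤cutCl : ∀ τ → forcedCut τ ≤ cutCl τ
    forcedCut≤cutCl τ = begin
      forcedCut τ                                                   ≡⟨ cong (crossTwins τ +_) (sum-cong-≗ {n} (inside*outside τ)) ⟩
      crossTwins τ + ∑[ u < n ] ∑[ v < n ] when (A u v) (siblingsLeaving τ u v)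
        ≡⟨ sym (∑∑-distrib-+ {n} {n} _ _) ⟩
      ∑[ u < n ] ∑[ v < n ] (when (A u v) ⟦ τ u v ∧ not (τ v u) ⟧ + when (A u v) (siblingsLeaving τ u v))
        ≤⟨ ∑-mono (λ u → ∑-mono (λ v → at u v)) ⟩
      cutCl τ                                                       ∎
      where
      open ≤-Reasoning
      at : ∀ u v → when (A u v) ⟦ τ u v ∧ not (τ v u) ⟧ + when (A u v) (siblingsLeaving τ u v) ≤ when (A u v) (leaving τ u v)
      at u v with A u v in Auv
      ... | true  = twin-and-siblings τ u v Auv
      ... | false = z≤n

    -- An edge {i , j} from X to V∖X is paid for by a twin edge crossing τ, by the dart (i , j) ∉ τ at i ∈ X,
    -- or by the dart (j , i) ∈ τ at j ∉ X.
    cutG≤ : ∀ τ X → cutG X ≤ crossTwins τ + ∑[ u < n ] when (X u) (outside τ u)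
                                          + ∑[ u < n ] when (not (X u)) (inside τ u)
    cutG≤ τ X = begin
      cutG X                                                        ≤⟨ ∑-mono (λ i → ∑-mono λ j → edge-split i j) ⟩
      ∑[ i < n ] ∑[ j < n ] (twinTerm i j + outTerm i j + inTerm i j) ≡⟨ ∑∑-distrib-+ {n} {n} _ _ ⟩
      ∑[ i < n ] ∑[ j < n ] (twinTerm i j + outTerm i j) + ∑[ i < n ] ∑[ j < n ] inTerm i j
        ≡⟨ cong₂ _+_ (trans (∑∑-distrib-+ {n} {n} _ _) (cong (crossTwins τ +_) outsides)) insides ⟩
      crossTwins τ + ∑[ u < n ] when (X u) (outside τ u) + ∑[ u < n ] when (not (X u)) (inside τ u) ∎
      where
      open ≤-Reasoning
      twinTerm outTerm inTerm : Fin n → Fin n → ℕ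
      twinTerm i j = when (A i j) ⟦ τ i j ∧ not (τ j i) ⟧
      outTerm  i j = when (X i) (when (A i j) ⟦ not (τ i j) ⟧)
      inTerm   i j = when (not (X j)) (when (A j i) ⟦ τ j i ⟧)
      split : ∀ xi xj c t₁ t₂ → ⟦ xi ∧ not xj ∧ c ⟧ ≤ when c ⟦ t₁ ∧ not t₂ ⟧ + when xi (when c ⟦ not t₁ ⟧) + when (not xj) (when c ⟦ t₂ ⟧)
      split false _     _     _     _     = z≤n
      split true  true  _     _     _     = z≤n
      split true  false false _     _     = z≤n
      split true  false true  true  true  = s≤s z≤n
      split true  false true  true  false = s≤s z≤n
      split true  false true  false _     = s≤s z≤n
      edge-split : ∀ i j → ⟦ X i ∧ not (X j) ∧ A i j ⟧ ≤ twinTerm i j + outTerm i j + inTerm i j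
      edge-split i j = subst (λ c → ⟦ X i ∧ not (X j) ∧ A i j ⟧ ≤ twinTerm i j + outTerm i j + when (not (X j)) (when c ⟦ τ j i ⟧))
                             (A-sym i j)
                             (split (X i) (X j) (A i j) (τ i j) (τ j i))
      outsides : ∑[ i < n ] ∑[ j < n ] outTerm i j ≡ ∑[ u < n ] when (X u) (outside τ u)
      outsides = sum-cong-≗ {n} λ i → sym (∑-when {n} (X i) _)
      insides : ∑[ i < n ] ∑[ j < n ] inTerm i j ≡ ∑[ u < n ] when (not (X u)) (inside τ u)
      insides = trans (∑-comm {n} {n} _) (sum-cong-≗ {n} λ j → sym (∑-when {n} (not (X j)) _))

    majority : DartSet → Fin n → Bool
    majority τ u = deg u <ᵇ 2 * inside τ u

    cutG+≤forcedCut : (∀ u → 3 ≤ deg u) → ∀ τ →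
                      cutG (majority τ) + ∑[ u < n ] when (not (majority τ u)) (inside τ u) ≤ forcedCut τ
    cutG+≤forcedCut δ≥3 τ = begin
      cutG X + K                  ≤⟨ +-monoˡ-≤ K (cutG≤ τ X) ⟩
      crossTwins τ + B + K + K    ≡⟨ regroup ⟩
      crossTwins τ + ∑[ u < n ] (when (X u) (outside τ u) + when (not (X u)) (inside τ u + inside τ u))
        ≤⟨ +-monoʳ-≤ (crossTwins τ) (∑-mono λ u → vertex-weight (inside τ u) (outside τ u) (deg u) (inside+outside τ u) (δ≥3 u)) ⟩
      forcedCut τ                 ∎
      where
      open ≤-Reasoning
      X : Fin n → Bool
      X = majority τ
      B K : ℕ
      B = ∑[ u < n ] when (X u) (outside τ u)
      K = ∑[ u < n ] when (not (X u)) (inside τ u)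
      regroup : crossTwins τ + B + K + K ≡
                crossTwins τ + ∑[ u < n ] (when (X u) (outside τ u) + when (not (X u)) (inside τ u + inside τ u))
      regroup = begin-equality
        crossTwins τ + B + K + K       ≡⟨ trans (+-assoc (crossTwins τ + B) K K) (+-assoc (crossTwins τ) B (K + K)) ⟩
        crossTwins τ + (B + (K + K))   ≡⟨ cong (λ z → crossTwins τ + (B + z)) (sym (∑-distrib-+ {n} _ _)) ⟩
        crossTwins τ + (B + ∑[ u < n ] (when (not (X u)) (inside τ u) + when (not (X u)) (inside τ u)))
          ≡⟨ cong (crossTwins τ +_) (sym (∑-distrib-+ {n} _ _)) ⟩
        crossTwins τ + ∑[ u < n ] (when (X u) (outside τ u) + (when (not (X u)) (inside τ u) + when (not (X u)) (inside τ u)))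
          ≡⟨ cong (crossTwins τ +_) (sum-cong-≗ {n} λ u → cong (when (X u) (outside τ u) +_) (sym (when-+ (not (X u)) _ _))) ⟩
        crossTwins τ + ∑[ u < n ] (when (X u) (outside τ u) + when (not (X u)) (inside τ u + inside τ u)) ∎

    ∑inside≤ : ∀ s τ X → (∀ u → inside τ u ≤ s) →
               ∑[ u < n ] inside τ u ≤ s * size X + ∑[ u < n ] when (not (X u)) (inside τ u)
    ∑inside≤ s τ X inside≤s = begin
      ∑[ u < n ] inside τ u                                                ≤⟨ ∑-mono at ⟩
      ∑[ u < n ] (s * ⟦ X u ⟧ + when (not (X u)) (inside τ u))             ≡⟨ ∑-distrib-+ {n} _ _ ⟩
      ∑[ u < n ] (s * ⟦ X u ⟧) + ∑[ u < n ] when (not (X u)) (inside τ u)   ≡⟨ cong (_+ _) (sym (*-distribˡ-sum {n} s _)) ⟩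
      s * size X + ∑[ u < n ] when (not (X u)) (inside τ u)                ∎
      where
      open ≤-Reasoning
      at : ∀ u → inside τ u ≤ s * ⟦ X u ⟧ + when (not (X u)) (inside τ u)
      at u with X u
      ... | true  = ≤-trans (inside≤s u) (≤-reflexive (sym (trans (+-identityʳ (s * 1)) (*-identityʳ s))))
      ... | false = m≤n+m (inside τ u) (s * 0)

    crossTwins-complement : ∀ τ → crossTwins (complement τ) ≡ crossTwins τ
    crossTwins-complement τ =
      trans (sum-cong-≗ {n} λ u → sum-cong-≗ {n} λ v → cong₂ when (A-sym u v) (flip (τ u v) (τ v u)))
            (∑-comm {n} {n} _)
      where
      flip : ∀ x y → ⟦ not x ∧ not (not y) ⟧ ≡ ⟦ y ∧ not x ⟧
      flip true  true  = refl
      flip true  false = refl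
      flip false true  = refl
      flip false false = refl

    forcedCut-complement : ∀ τ → forcedCut (complement τ) ≡ forcedCut τ
    forcedCut-complement τ = cong₂ _+_ (crossTwins-complement τ)
      (sum-cong-≗ {n} λ u → trans (cong (outside τ u *_) (outside-complement τ u)) (*-comm (outside τ u) (inside τ u)))

    -- The majority sets of τ and of its complement are disjoint, so one of them has at most n/2 vertices.
    size-disjoint : ∀ X Y → (∀ u → X u ∧ Y u ≡ false) → size X + size Y ≤ n
    size-disjoint X Y disjoint =
      ≤-trans (≤-reflexive (trans (sym (∑-distrib-+ {n} _ _)) (sum-cong-≗ {n} λ u → union (X u) (Y u) (disjoint u))))
              (∑-indicator-≤ (λ u → X u ∨ Y u))
      where
      union : ∀ x y → x ∧ y ≡ false → ⟦ x ⟧ + ⟦ y ⟧ ≡ ⟦ x ∨ y ⟧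
      union true  false _ = refl
      union false y     _ = refl

    majorities-disjoint : ∀ τ u → majority τ u ∧ majority (complement τ) u ≡ false
    majorities-disjoint τ u with majority τ u in maj | majority (complement τ) u in maj'
    ... | false | _     = refl
    ... | true  | false = refl
    ... | true  | true  = ⊥-elim (no-two-majorities (inside τ u) (outside τ u) (more-than-half (inside τ u) maj) (more-than-half (outside τ u) maj'))
      where
      more-than-half : ∀ a → (deg u <ᵇ 2 * a) ≡ true → inside τ u + outside τ u < 2 * a
      more-than-half a e = subst (_< 2 * a) (sym (inside+outside τ u)) (<ᵇ⇒< (deg u) (2 * a) (subst T (sym e) tt))

    small-majority : ∀ τ → 2 * size (majority τ) ≤ n ⊎ 2 * size (majority (complement τ)) ≤ n
    small-majority τ with 2 * size (majority τ) ≤? n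
    ... | yes small = inj₁ small
    ... | no  large = inj₂ (begin
      2 * y      ≡⟨ cong (y +_) (+-identityʳ y) ⟩
      y + y      ≤⟨ +-monoˡ-≤ y (<⇒≤ (+-cancelˡ-< x y x x+y<x+x)) ⟩
      x + y      ≤⟨ x+y≤n ⟩
      n          ∎)
      where
      open ≤-Reasoning
      X = majority τ
      x = size X
      y = size (majority (complement τ))
      x+y≤n : x + y ≤ n
      x+y≤n = size-disjoint X (majority (complement τ)) (majorities-disjoint τ)
      x+y<x+x : x + y < x + x
      x+y<x+x = <-≤-trans (s≤s x+y≤n) (≤-trans (≰⇒> large) (≤-reflexive (cong (x +_) (+-identityʳ x))))

    -- Expansion tested on a single vertex v bounds the expansion constant by deg v.
    expansion-≤-degree : ∀ {P Q} → Expands P Q → 2 ≤ n → ∀ v → P ≤ deg v * Q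
    expansion-≤-degree {P} {Q} expands 2≤n v = begin
      P                ≡⟨ sym (trans (cong (P *_) size-singleton) (*-identityʳ P)) ⟩
      P * size (_== v) ≤⟨ expands (_== v) (≤-trans (≤-reflexive (cong (2 *_) size-singleton)) 2≤n) ⟩
      cutG (_== v) * Q ≤⟨ *-monoˡ-≤ Q cut-singleton ⟩
      deg v * Q        ∎
      where
      open ≤-Reasoning
      size-singleton : size (_== v) ≡ 1
      size-singleton = ∑-singleton v (λ _ → 1)
      out-edge : ∀ x y c → ⟦ x ∧ not y ∧ c ⟧ ≤ when x ⟦ c ⟧
      out-edge true  true  c = z≤n
      out-edge true  false c = ≤-refl
      out-edge false y     c = z≤n
      cut-singleton : cutG (_== v) ≤ deg v
      cut-singleton = ≤-trans (∑-mono λ i → ≤-trans (∑-mono λ j → out-edge (i == v) (j == v) (A i j))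
                                                     (≤-reflexive (sym (∑-when {n} (i == v) _))))
                              (≤-reflexive (∑-singleton v deg))

    module _ (s : ℕ) (δ≥3 : ∀ u → 3 ≤ deg u) (Δ≤s : ∀ u → deg u ≤ s)
             {P Q : ℕ} (expands : Expands P Q) (P≤sQ : P ≤ s * Q) where

      majority-transfer : ∀ τ → 2 * size (majority τ) ≤ n → P * ∑[ u < n ] inside τ u ≤ forcedCut τ * (s * Q)
      majority-transfer τ small = begin
        P * ∑[ u < n ] inside τ u      ≤⟨ *-monoʳ-≤ P (∑inside≤ s τ X inside≤s) ⟩
        P * (s * x + K)                ≡⟨ expand P s x K ⟩
        s * (P * x) + P * K            ≤⟨ +-mono-≤ (*-monoʳ-≤ s (expands X small)) (*-monoˡ-≤ K P≤sQ) ⟩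
        s * (cutG X * Q) + s * Q * K   ≡⟨ collect s (cutG X) Q K ⟩
        (cutG X + K) * (s * Q)         ≤⟨ *-monoˡ-≤ (s * Q) (cutG+≤forcedCut δ≥3 τ) ⟩
        forcedCut τ * (s * Q)          ∎
        where
        open ≤-Reasoning
        X = majority τ
        x = size X
        K = ∑[ u < n ] when (not (X u)) (inside τ u)
        inside≤s : ∀ u → inside τ u ≤ s
        inside≤s u = ≤-trans (m≤m+n _ _) (≤-trans (≤-reflexive (inside+outside τ u)) (Δ≤s u))
        expand : ∀ P s x K → P * (s * x + K) ≡ s * (P * x) + P * K
        expand = solve-∀
        collect : ∀ s g Q K → s * (g * Q) + s * Q * K ≡ (g + K) * (s * Q)
        collect = solve-∀

      transfer : ∀ τ → P * (∑[ u < n ] inside τ u ⊓ ∑[ u < n ] outside τ u) ≤ cutCl τ * (s * Q)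
      transfer τ with small-majority τ
      ... | inj₁ small = begin
        P * (∑[ u < n ] inside τ u ⊓ ∑[ u < n ] outside τ u) ≤⟨ *-monoʳ-≤ P (m⊓n≤m _ _) ⟩
        P * ∑[ u < n ] inside τ u                            ≤⟨ majority-transfer τ small ⟩
        forcedCut τ * (s * Q)                                ≤⟨ *-monoˡ-≤ (s * Q) (forcedCut≤cutCl τ) ⟩
        cutCl τ * (s * Q)                                    ∎
        where open ≤-Reasoning
      ... | inj₂ small = begin
        P * (∑[ u < n ] inside τ u ⊓ ∑[ u < n ] outside τ u) ≤⟨ *-monoʳ-≤ P (m⊓n≤n _ _) ⟩
        P * ∑[ u < n ] inside (complement τ) u               ≤⟨ majority-transfer (complement τ) small ⟩
        forcedCut (complement τ) * (s * Q)                   ≡⟨ cong (_* (s * Q)) (forcedCut-complement τ) ⟩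
        forcedCut τ * (s * Q)                                ≤⟨ *-monoˡ-≤ (s * Q) (forcedCut≤cutCl τ) ⟩
        cutCl τ * (s * Q)                                    ∎
        where open ≤-Reasoning

  sum-tabulate : ∀ {k} (f : Fin k → ℕ) → sum (tabulate f) ≡ ∑ f
  sum-tabulate {zero}  f = refl
  sum-tabulate {suc k} f = cong (f zero +_) (sum-tabulate (f ∘ suc))

  sum-allFin : ∀ k (f : Fin k → ℕ) → sum (map f (allFin k)) ≡ ∑ f
  sum-allFin k f = trans (cong sum (map-tabulate id f)) (sum-tabulate f)

  sum-lookup : ∀ {A : Set} (L : List A) (F : A → ℕ) → ∑[ i < length L ] F (lookup L i) ≡ sum (map F L)
  sum-lookup []      F = refl
  sum-lookup (x ∷ L) F = cong (F x +_) (sum-lookup L F)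

  sum-concatMap : ∀ {A B : Set} (h : A → List B) (F : B → ℕ) xs →
                  sum (map F (concatMap h xs)) ≡ sum (map (λ x → sum (map F (h x))) xs)
  sum-concatMap h F []       = refl
  sum-concatMap h F (x ∷ xs) = begin
    sum (map F (h x ++ concatMap h xs))                 ≡⟨ cong sum (map-++ F (h x) _) ⟩
    sum (map F (h x) ++ map F (concatMap h xs))         ≡⟨ sum-++ (map F (h x)) _ ⟩
    sum (map F (h x)) + sum (map F (concatMap h xs))    ≡⟨ cong (sum (map F (h x)) +_) (sum-concatMap h F xs) ⟩
    sum (map F (h x)) + sum (map (λ x → sum (map F (h x))) xs) ∎
    where open ≡-Reasoning

  sum-filter : ∀ {A : Set} (p : A → Bool) (F : A → ℕ) xs →
               sum (map F (filterᵇ p xs)) ≡ sum (map (λ x → when (p x) (F x)) xs)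
  sum-filter p F []       = refl
  sum-filter p F (x ∷ xs) with p x
  ... | true  = cong (F x +_) (sum-filter p F xs)
  ... | false = sum-filter p F xs

  countTrue-∑ : ∀ {k} (T : Vec Bool k) → countTrue T ≡ ∑[ i < k ] ⟦ Vec.lookup T i ⟧
  countTrue-∑ []          = refl
  countTrue-∑ (true ∷ T)  = cong suc (countTrue-∑ T)
  countTrue-∑ (false ∷ T) = countTrue-∑ T

  countTrue-tabulate : ∀ {k} (X : Fin k → Bool) → countTrue (Vec.tabulate X) ≡ ∑[ i < k ] ⟦ X i ⟧
  countTrue-tabulate {k} X = trans (countTrue-∑ (Vec.tabulate X)) (sum-cong-≗ {k} λ i → cong ⟦_⟧ (lookup∘tabulate X i))

  module _ {K : Set} (_≟_ : DecidableEquality K) where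

    predicateOf : (L : List K) → Vec Bool (length L) → K → Bool
    predicateOf []      []      x = false
    predicateOf (y ∷ L) (b ∷ T) x = if does (y ≟ x) then b else predicateOf L T x

    predicateOf-lookup : ∀ L → Unique L → (T : Vec Bool (length L)) →
                         ∀ i → Vec.lookup T i ≡ predicateOf L T (lookup L i)
    predicateOf-lookup (y ∷ L) (y∉L ∷ L!) (b ∷ T) zero with y ≟ y
    ... | yes _   = refl
    ... | no  y≢y = ⊥-elim (y≢y refl)
    predicateOf-lookup (y ∷ L) (y∉L ∷ L!) (b ∷ T) (suc i) with y ≟ lookup L i
    ... | yes y≡Li = ⊥-elim (All.lookup y∉L (∈-lookup i) y≡Li)
    ... | no  _    = predicateOf-lookup L L! T i

  module _ (G : Graph) where

    dartsAt : Fin (n G) → List (Fin (n G) × Fin (n G))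
    dartsAt u = map (u ,_) (filterᵇ (adj G u) (allFin (n G)))

    sum-darts : ∀ (F : Fin (n G) × Fin (n G) → ℕ) →
                sum (map F (darts G)) ≡ ∑[ u < n G ] ∑[ v < n G ] when (adj G u v) (F (u , v))
    sum-darts F = trans (sum-concatMap dartsAt F (allFin (n G)))
                        (trans (cong sum (map-cong at (allFin (n G)))) (sum-allFin (n G) _))
      where
      at : ∀ u → sum (map F (dartsAt u)) ≡ ∑[ v < n G ] when (adj G u v) (F (u , v))
      at u = trans (cong sum (sym (map-∘ (filterᵇ (adj G u) (allFin (n G))))))
                   (trans (sum-filter (adj G u) (F ∘ (u ,_)) (allFin (n G))) (sum-allFin (n G) _))

    darts-unique : Unique (darts G)
    darts-unique = AllPairs.concat⁺ (All.map⁺ (All.universal dartsAt-unique _))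
                                    (AllPairs.map⁺ (AllPairs.map dartsAt-apart (Unique.allFin⁺ (n G))))
      where
      dartsAt-unique : ∀ u → Unique (dartsAt u)
      dartsAt-unique u = Unique.map⁺ (cong proj₂) (Unique.filter⁺ (T? ∘ adj G u) (Unique.allFin⁺ (n G)))
      dartsAt-apart : ∀ {u w} → ¬ u ≡ w → All (λ d → All (λ d' → ¬ d ≡ d') (dartsAt w)) (dartsAt u)
      dartsAt-apart u≢w = All.map⁺ (All.universal (λ _ → All.map⁺ (All.universal (λ _ → u≢w ∘ cong proj₁) _)) _)

    dartSet : Vec Bool (length (darts G)) → Fin (n G) → Fin (n G) → Bool
    dartSet T u v = predicateOf (≡-dec Fin._≟_ Fin._≟_) (darts G) T (u , v)

    dartSet-lookup : ∀ T i → Vec.lookup T i ≡ dartSet T (proj₁ (lookup (darts G) i)) (proj₂ (lookup (darts G) i))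
    dartSet-lookup T = predicateOf-lookup (≡-dec Fin._≟_ Fin._≟_) (darts G) darts-unique T

  ≤-frac⇒cross : ∀ P q g b .{cp : Coprime P (suc q)} →
                 mkℚ (ℤ.+ P) q cp ℚ.≤ frac g (suc b) → P * suc b ≤ g * suc q
  ≤-frac⇒cross P q g b le with ℚᵘ.≤-respʳ-≃ (ℚ.toℚᵘ-fromℚᵘ (mkℚᵘ (ℤ.+ g) b)) (ℚ.toℚᵘ-mono-≤ le)
  ... | ℚᵘ.*≤* h = ℤ.drop‿+≤+ (subst₂ ℤ._≤_ (sym (ℤ.pos-* P (suc b))) (sym (ℤ.pos-* g (suc q))) h)

  cross⇒scaled-≤-frac : ∀ P q c m s .{cp : Coprime P (suc q)} → 0 < m → P * m ≤ c * (suc s * suc q) →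
                        frac 1 (suc s) ℚ.* mkℚ (ℤ.+ P) q cp ℚ.≤ frac c m
  cross⇒scaled-≤-frac P q c (suc m) s {cp} _ h = ℚ.toℚᵘ-cancel-≤
    (ℚᵘ.≤-respˡ-≃ (ℚᵘ.≃-sym product) (ℚᵘ.≤-respʳ-≃ (ℚᵘ.≃-sym (ℚ.toℚᵘ-fromℚᵘ (mkℚᵘ (ℤ.+ c) m))) unnormalised))
    where
    product : ℚ.toℚᵘ (frac 1 (suc s) ℚ.* mkℚ (ℤ.+ P) q cp) ℚᵘ.≃ mkℚᵘ (ℤ.+ 1) s ℚᵘ.* mkℚᵘ (ℤ.+ P) q
    product = ℚᵘ.≃-trans (ℚ.toℚᵘ-homo-* (frac 1 (suc s)) (mkℚ (ℤ.+ P) q cp))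
                         (ℚᵘ.*-congʳ (ℚ.toℚᵘ-fromℚᵘ (mkℚᵘ (ℤ.+ 1) s)))
    unnormalised : mkℚᵘ (ℤ.+ 1) s ℚᵘ.* mkℚᵘ (ℤ.+ P) q ℚᵘ.≤ mkℚᵘ (ℤ.+ c) m
    unnormalised = ℚᵘ.*≤* (subst₂ ℤ._≤_ lhs (ℤ.pos-* c (suc s * suc q)) (ℤ.+≤+ h))
      where
      lhs : ℤ.+ (P * suc m) ≡ (ℤ.+ 1 ℤ.* ℤ.+ P) ℤ.* ℤ.+ suc m
      lhs = trans (ℤ.pos-* P (suc m)) (cong (ℤ._* ℤ.+ suc m) (sym (ℤ.*-identityˡ (ℤ.+ P))))

  frac-nonneg : ∀ a b → 0ℚ ℚ.≤ frac a b
  frac-nonneg a zero    = ℚ.≤-refl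
  frac-nonneg a (suc b) = ℚ.nonNegative⁻¹ _ {{ℚ.normalize-nonNeg a (suc b)}}

  minList-≤ : ∀ {x} xs → x ∈ xs → minList xs ℚ.≤ x
  minList-≤ (y ∷ ys) x∈ = go ys x∈
    where
    go : ∀ {x} zs → x ∈ y ∷ zs → foldr ℚ._⊓_ y zs ℚ.≤ x
    go []       (here refl)         = ℚ.≤-refl
    go (z ∷ zs) (here refl)         = ℚ.≤-trans (ℚ.p⊓q≤q z _) (go zs (here refl))
    go (z ∷ zs) (there (here refl)) = ℚ.p⊓q≤p z _
    go (z ∷ zs) (there (there x∈))  = ℚ.≤-trans (ℚ.p⊓q≤q z _) (go zs (there x∈))

  ≤-minList : ∀ q xs {x₀} → x₀ ∈ xs → (∀ {x} → x ∈ xs → q ℚ.≤ x) → q ℚ.≤ minList xs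
  ≤-minList q (y ∷ ys) _ lower = go ys (λ x∈ → lower (there x∈))
    where
    go : ∀ zs → (∀ {x} → x ∈ zs → q ℚ.≤ x) → q ℚ.≤ foldr ℚ._⊓_ y zs
    go []       _      = lower (here refl)
    go (z ∷ zs) lower' = ℚ.⊓-glb (lower' (here refl)) (go zs (λ x∈ → lower' (there x∈)))

  ≤-minList-map : ∀ {A : Set} (f : A → ℚ) q xs {x₀} → x₀ ∈ xs → (∀ {x} → x ∈ xs → q ℚ.≤ f x) → q ℚ.≤ minList (map f xs)
  ≤-minList-map f q (y ∷ ys) _ lower = ≤-minList q (map f (y ∷ ys)) (here refl) λ fx∈ → bound (∈-map⁻ f fx∈)
    where
    bound : ∀ {z} → ∃ (λ x → x ∈ y ∷ ys × z ≡ f x) → q ℚ.≤ z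
    bound (x , x∈ , refl) = lower x∈

  Ex-nonneg : ∀ G → 0ℚ ℚ.≤ Ex G
  Ex-nonneg G with map (ExS G) (properSubsets G) in eq
  ... | []     = ℚ.≤-refl
  ... | x ∷ xs = ≤-minList 0ℚ (x ∷ xs) (here refl) λ {y} y∈ → nonneg (∈-map⁻ (ExS G) (subst (y ∈_) (sym eq) y∈))
    where
    nonneg : ∀ {y} → ∃ (λ S → S ∈ properSubsets G × y ≡ ExS G S) → 0ℚ ℚ.≤ y
    nonneg (S , _ , refl) = frac-nonneg (cut G S) (countTrue S ⊓ (n G ∸ countTrue S))

  allSubsets-complete : ∀ k (S : Vec Bool k) → S ∈ allSubsets k
  allSubsets-complete zero    []          = here refl
  allSubsets-complete (suc k) (true ∷ S)  = ∈-concat⁺′ (here refl) (∈-map⁺ (λ S → (true ∷ S) ∷ (false ∷ S) ∷ []) (allSubsets-complete k S))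
  allSubsets-complete (suc k) (false ∷ S) = ∈-concat⁺′ (there (here refl)) (∈-map⁺ (λ S → (true ∷ S) ∷ (false ∷ S) ∷ []) (allSubsets-complete k S))

  isProper : (G : Graph) → Vec Bool (n G) → Bool
  isProper G S = (0 <ᵇ countTrue S) ∧ (countTrue S <ᵇ n G)

  proper-subset : ∀ G (S : Vec Bool (n G)) → 0 < countTrue S → countTrue S < n G → S ∈ properSubsets G
  proper-subset G S nonempty proper =
    ∈-filter⁺ (T? ∘ isProper G) (allSubsets-complete (n G) S) (Equivalence.from T-∧ (<⇒<ᵇ nonempty , <⇒<ᵇ proper))

  size-of-proper : ∀ G {S} → S ∈ properSubsets G → 0 < countTrue S × countTrue S < n G
  size-of-proper G {S} S∈ with Equivalence.to T-∧ (proj₂ (∈-filter⁻ (T? ∘ isProper G) {xs = allSubsets (n G)} S∈))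
  ... | nonempty , proper = <ᵇ⇒< _ _ nonempty , <ᵇ⇒< _ _ proper

  has-proper-subset : ∀ G → 2 ≤ n G → ∃ λ S → S ∈ properSubsets G
  has-proper-subset G 2≤n = S , proper-subset G S (subst (0 <_) (sym one) (s≤s z≤n)) (subst (_< n G) (sym one) 2≤n)
    where
    v : Fin (n G)
    v = fromℕ< (≤-trans (s≤s z≤n) 2≤n)
    S : Vec Bool (n G)
    S = Vec.tabulate (_== v)
    one : countTrue S ≡ 1
    one = trans (countTrue-tabulate (_== v)) (∑-singleton v (λ _ → 1))

  module _ (G : Graph) (simple : IsSimple G) where
    open Clustering (adj G) (proj₁ simple) (proj₂ simple)

    private
      N = length (darts G)
      D = darts G

    degree≡deg : ∀ u → degree G u ≡ deg u
    degree≡deg u = countTrue-tabulate (adj G u)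

    cut≡cutG : ∀ X → cut G (Vec.tabulate X) ≡ cutG X
    cut≡cutG X = trans (sum-allFin (n G) _) (sum-cong-≗ {n G} λ i → trans (sum-allFin (n G) _) (sum-cong-≗ {n G} λ j →
                   cong₂ (λ x y → ⟦ x ∧ not y ∧ adj G i j ⟧) (lookup∘tabulate X i) (lookup∘tabulate X j)))

    darts-degrees : N ≡ ∑[ u < n G ] deg u
    darts-degrees = trans (length-as-sum D) (sum-darts G (λ _ → 1))
      where
      length-as-sum : ∀ {A : Set} (xs : List A) → length xs ≡ sum (map (λ _ → 1) xs)
      length-as-sum []       = refl
      length-as-sum (x ∷ xs) = cong suc (length-as-sum xs)

    module _ (T : Vec Bool N) where
      private
        τ = dartSet G T
        inT : Fin (n G) × Fin (n G) → Bool
        inT (u , v) = τ u v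

      size-T : countTrue T ≡ ∑[ u < n G ] inside τ u
      size-T = begin
        countTrue T                                   ≡⟨ countTrue-∑ T ⟩
        ∑[ i < N ] ⟦ Vec.lookup T i ⟧                 ≡⟨ sum-cong-≗ {N} (cong ⟦_⟧ ∘ dartSet-lookup G T) ⟩
        ∑[ i < N ] ⟦ inT (lookup D i) ⟧               ≡⟨ sum-lookup D (⟦_⟧ ∘ inT) ⟩
        sum (map (⟦_⟧ ∘ inT) D)                       ≡⟨ sum-darts G (⟦_⟧ ∘ inT) ⟩
        ∑[ u < n G ] inside τ u                       ∎
        where open ≡-Reasoning

      darts-count : N ≡ ∑[ u < n G ] inside τ u + ∑[ u < n G ] outside τ u
      darts-count = trans darts-degrees
        (trans (sum-cong-≗ {n G} (sym ∘ inside+outside τ)) (∑-distrib-+ {n G} _ _))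

      cut-T : cut (Cl G) T ≡ cutCl τ
      cut-T = begin
        cut (Cl G) T                                                 ≡⟨ trans (sum-allFin N _) (sum-cong-≗ {N} λ i → sum-allFin N _) ⟩
        ∑[ i < N ] ∑[ j < N ] ⟦ Vec.lookup T i ∧ not (Vec.lookup T j) ∧ clAdj (lookup D i) (lookup D j) ⟧
          ≡⟨ sum-cong-≗ {N} (λ i → sum-cong-≗ {N} λ j → cong₂ (λ x y → ⟦ x ∧ not y ∧ clAdj (lookup D i) (lookup D j) ⟧)
                                                            (dartSet-lookup G T i) (dartSet-lookup G T j)) ⟩
        ∑[ i < N ] ∑[ j < N ] H (lookup D i) (lookup D j)            ≡⟨ sum-cong-≗ {N} (λ i → trans (sum-lookup D _) (sum-darts G _)) ⟩
        ∑[ i < N ] leavingDart (lookup D i)                          ≡⟨ trans (sum-lookup D leavingDart) (sum-darts G leavingDart) ⟩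
        cutCl τ                                                      ∎
        where
        open ≡-Reasoning
        H : Fin (n G) × Fin (n G) → Fin (n G) × Fin (n G) → ℕ
        H d d' = ⟦ inT d ∧ not (inT d') ∧ clAdj d d' ⟧
        leavingDart : Fin (n G) × Fin (n G) → ℕ
        leavingDart (u , v) = leaving τ u v

    Cl-bound : ∀ s' P q .{cp : Coprime P (suc q)} → (∀ u → 3 ≤ deg u) → (∀ u → deg u ≤ suc s') →
               Expands P (suc q) → P ≤ suc s' * suc q →
               ∀ T → T ∈ properSubsets (Cl G) → frac 1 (suc s') ℚ.* mkℚ (ℤ.+ P) q cp ℚ.≤ ExS (Cl G) T
    Cl-bound s' P q δ≥3 Δ≤s expands P≤sQ T T∈ = cross⇒scaled-≤-frac P q (cut (Cl G) T) (t ⊓ (N ∸ t)) s'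
      (⊓-glb 0<t (m<n⇒0<n∸m t<N))
      (subst₂ (λ m c → P * m ≤ c * (suc s' * suc q)) (sym min≡) (sym (cut-T T))
              (transfer (suc s') δ≥3 Δ≤s expands P≤sQ (dartSet G T)))
      where
      t = countTrue T
      0<t : 0 < t
      0<t = proj₁ (size-of-proper (Cl G) T∈)
      t<N : t < N
      t<N = proj₂ (size-of-proper (Cl G) T∈)
      min≡ : t ⊓ (N ∸ t) ≡ ∑[ u < n G ] inside (dartSet G T) u ⊓ ∑[ u < n G ] outside (dartSet G T) u
      min≡ = cong₂ _⊓_ (size-T T) (trans (cong₂ _∸_ (darts-count T) (size-T T)) (m+n∸m≡n (∑[ u < n G ] inside (dartSet G T) u) _))

    expands-from-Ex : ∀ P q .{cp : Coprime P (suc q)} →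
                      (∀ S → S ∈ properSubsets G → mkℚ (ℤ.+ P) q cp ℚ.≤ ExS G S) → Expands P (suc q)
    expands-from-Ex P q {cp} lower X small with size X in size≡
    ... | zero  = subst (_≤ cutG X * suc q) (sym (*-zeroʳ P)) z≤n
    ... | suc x = ≤-frac⇒cross P q (cutG X) x (subst (mkℚ (ℤ.+ P) q cp ℚ.≤_) ExS≡ (lower _ S∈))
      where
      count : countTrue (Vec.tabulate X) ≡ suc x
      count = trans (countTrue-tabulate X) size≡
      x+x≤n : suc x + suc x ≤ n G
      x+x≤n = subst (_≤ n G) (cong (suc x +_) (+-identityʳ (suc x))) small
      x≤n∸x : suc x ≤ n G ∸ suc x
      x≤n∸x = m+n≤o⇒m≤o∸n (suc x) x+x≤n
      S∈ : Vec.tabulate X ∈ properSubsets G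
      S∈ = proper-subset G _ (subst (0 <_) (sym count) (s≤s z≤n))
                             (subst (_< n G) (sym count) (<-≤-trans (m<m+n (suc x) (s≤s z≤n)) x+x≤n))
      ExS≡ : ExS G (Vec.tabulate X) ≡ frac (cutG X) (suc x)
      ExS≡ = cong₂ frac (cut≡cutG X) (trans (cong (λ c → c ⊓ (n G ∸ c)) count) (m≤n⇒m⊓n≡m x≤n∸x))

    module _ (s' : ℕ) (δ≥3 : ∀ u → 3 ≤ deg u) (Δ≤s : ∀ u → deg u ≤ suc s') (v₀ : Fin (n G)) where

      2≤n : 2 ≤ n G
      2≤n = ≤-trans (n≤1+n 2) (≤-trans (δ≥3 v₀) (∑-indicator-≤ (adj G v₀)))

      Cl-has-proper-subset : ∃ λ T → T ∈ properSubsets (Cl G)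
      Cl-has-proper-subset = has-proper-subset (Cl G)
        (≤-trans (n≤1+n 2) (≤-trans (δ≥3 v₀) (≤-trans (∑-term deg v₀) (≤-reflexive (sym darts-degrees)))))

      scaled-bound : ∀ E → 0ℚ ℚ.≤ E → (∀ S → S ∈ properSubsets G → E ℚ.≤ ExS G S) → frac 1 (suc s') ℚ.* E ℚ.≤ Ex (Cl G)
      scaled-bound (mkℚ (ℤ.+ P) q _) _ lower =
        ≤-minList-map (ExS (Cl G)) _ (properSubsets (Cl G)) (proj₂ Cl-has-proper-subset)
          λ {T} T∈ → Cl-bound s' P q δ≥3 Δ≤s expands P≤sQ T T∈
        where
        expands : Expands P (suc q)
        expands = expands-from-Ex P q lower
        P≤sQ : P ≤ suc s' * suc q
        P≤sQ = ≤-trans (expansion-≤-degree expands 2≤n v₀) (*-monoˡ-≤ (suc q) (Δ≤s v₀))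
      scaled-bound (mkℚ -[1+ _ ] _ _) (ℚ.*≤* ()) _

open ClusteringExpansion using (scaled-bound; degree≡deg; Ex-nonneg; minList-≤)
open import Defs
open import Data.Nat using (ℕ; zero; suc; _≤_)
open import Data.List.Membership.Propositional.Properties using (∈-map⁺)
open import Data.Product using (∃; _,_)
open import Data.Rational using (_*_) renaming (_≤_ to _≤ℚ_)
open import Relation.Binary.PropositionalEquality using (_≡_; subst)

lemma8 : (G : Graph) → IsSimple G → (s : ℕ)
           → (∀ v → 3 ≤ degree G v)
           → (∃ λ v → degree G v ≡ s) → (∀ v → degree G v ≤ s)
           → frac 1 s * Ex G ≤ℚ Ex (Cl G)
lemma8 G simple zero δ≥3 (v₀ , deg≡0) _ with subst (3 ≤_) deg≡0 (δ≥3 v₀)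
... | ()
lemma8 G simple (suc s') δ≥3 (v₀ , _) Δ≤s =
  scaled-bound G simple s' (λ u → subst (3 ≤_) (degree≡deg G simple u) (δ≥3 u))
                           (λ u → subst (_≤ suc s') (degree≡deg G simple u) (Δ≤s u)) v₀
               (Ex G) (Ex-nonneg G) (λ S S∈ → minList-≤ _ (∈-map⁺ (ExS G) S∈))
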